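{- Let $p$ be a prime and let $\bigl(I\colon\Pi_n\to\mathbb{Z}/p\mathbb{Z}\bigr)_{n\ge1}$ be a sequence of functions satisfying the chain rule: for all $n,k_1,\dots,k_n\ge1$, $\pi\in\Pi_n$, $\gamma^i\in\Pi_{k_i}$, $I(\pi\circ(\gamma^1,\dots,\gamma^n))=I(\pi)+\sum_i\pi_iI(\gamma^i)$. Then $I(u_{n+p^2})=I(u_n)$ for all natural numbers $n$ not divisible by $p$.
   Context: $\Pi_n=\{\pi\in(\mathbb{Z}/p\mathbb{Z})^n:\sum_i\pi_i=1\}$. For $\gamma^i=(\gamma^i_1,\dots,\gamma^i_{k_i})$, $\pi\circ(\gamma^1,\dots,\gamma^n)=(\pi_1\gamma^1_1,\dots,\pi_1\gamma^1_{k_1},\dots,\pi_n\gamma^n_1,\dots,\pi_n\gamma^n_{k_n})\in\Pi_{k_1+\cdots+k_n}$. For $p\nmid n$, $u_n=(1/n,\dots,1/n)\in\Pi_n$ is the uniform distribution. -}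

module Defs where

open import Data.Nat using (ℕ; zero; suc; _+_; _*_; _∸_; _^_; _<_; NonZero)
open import Data.Nat.Properties
open import Data.Nat.DivMod using (_%_; m%n<n; m<n⇒m%n≡m; %-distribˡ-+; %-distribˡ-*; m%n%n≡m%n; [m+n]%n≡m%n; [m+kn]%n≡m%n)
open import Data.Nat.Divisibility using (_∣_; _∤_; ∣m+n∣m⇒∣n; m∣m*n)
open import Data.Nat.Primality using (Prime; prime⇒nonZero; prime⇒irreducible)
open import Data.Nat.Coprimality using (Coprime; coprime-Bézout)
open import Data.Nat.GCD using (module Bézout)
open import Data.Fin using (Fin; toℕ; fromℕ<)
open import Data.Fin.Properties using (toℕ-fromℕ<; toℕ-injective; toℕ<n)
open import Data.Vec using (Vec; []; _∷_; lookup; map; _++_; replicate; tabulate)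
import Data.Vec as V
open import Data.Product using (Σ; _,_; proj₁; proj₂)
open import Data.Sum using (inj₁; inj₂)
open import Function using (_∘_)
open import Relation.Nullary using (contradiction)
open import Relation.Binary.PropositionalEquality
open import Data.Nat.Solver using (module +-*-Solver)

module ZMod (p : ℕ) (pr : Prime p) where

  instance
    p≢0 : NonZero p
    p≢0 = prime⇒nonZero pr

  Zp : Set
  Zp = Fin p

  ι : ℕ → Zp
  ι m = fromℕ< (m%n<n m p)

  infixl 6 _⊕_
  infixl 7 _⊗_

  _⊕_ : Zp → Zp → Zp
  a ⊕ b = ι (toℕ a + toℕ b)

  _⊗_ : Zp → Zp → Zp
  a ⊗ b = ι (toℕ a * toℕ b)

  𝟘 𝟙 : Zp
  𝟘 = ι 0
  𝟙 = ι 1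

  sumZ : ∀ {n} → Vec Zp n → Zp
  sumZ []       = 𝟘
  sumZ (a ∷ v)  = a ⊕ sumZ v

  Π : ℕ → Set
  Π n = Σ (Vec Zp n) (λ v → sumZ v ≡ 𝟙)

  _!_ : ∀ {n} → Π n → Fin n → Zp
  π ! i = lookup (proj₁ π) i

  compVec : ∀ {n} (π : Vec Zp n) (ks : Vec ℕ n) →
            ((i : Fin n) → Vec Zp (lookup ks i)) → Vec Zp (V.sum ks)
  compVec []      []       γ = []
  compVec (a ∷ π) (k ∷ ks) γ = map (a ⊗_) (γ Fin.zero) ++ compVec π ks (γ ∘ Fin.suc)
    where import Data.Fin as Fin

  _≈_ : ℕ → ℕ → Set
  a ≈ b = a % p ≡ b % p

  ⟦_⟧ : ∀ {n} → Vec Zp n → ℕ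
  ⟦ v ⟧ = V.sum (map toℕ v)

  toℕ-ι : ∀ m → toℕ (ι m) ≡ m % p
  toℕ-ι m = toℕ-fromℕ< (m%n<n m p)

  ι-toℕ≈ : ∀ m → toℕ (ι m) ≈ m
  ι-toℕ≈ m = trans (cong (_% p) (toℕ-ι m)) (m%n%n≡m%n m p)

  ≈-+ : ∀ {a b c d} → a ≈ b → c ≈ d → (a + c) ≈ (b + d)
  ≈-+ {a} {b} {c} {d} e f = begin
    (a + c) % p             ≡⟨ %-distribˡ-+ a c p ⟩
    (a % p + c % p) % p     ≡⟨ cong₂ (λ x y → (x + y) % p) e f ⟩
    (b % p + d % p) % p     ≡⟨ sym (%-distribˡ-+ b d p) ⟩
    (b + d) % p ∎
    where open ≡-Reasoning

  ≈-* : ∀ {a b c d} → a ≈ b → c ≈ d → (a * c) ≈ (b * d)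
  ≈-* {a} {b} {c} {d} e f = begin
    (a * c) % p             ≡⟨ %-distribˡ-* a c p ⟩
    (a % p * (c % p)) % p   ≡⟨ cong₂ (λ x y → (x * y) % p) e f ⟩
    (b % p * (d % p)) % p   ≡⟨ sym (%-distribˡ-* b d p) ⟩
    (b * d) % p ∎
    where open ≡-Reasoning

  sumZ≈ : ∀ {n} (v : Vec Zp n) → toℕ (sumZ v) ≈ ⟦ v ⟧
  sumZ≈ []      = ι-toℕ≈ 0
  sumZ≈ (a ∷ v) = trans (ι-toℕ≈ (toℕ a + toℕ (sumZ v))) (≈-+ {toℕ a} refl (sumZ≈ v))

  ≈⇒≡ : ∀ {a b : Zp} → toℕ a ≈ toℕ b → a ≡ b
  ≈⇒≡ {a} {b} e = toℕ-injective (trans (sym (m<n⇒m%n≡m (toℕ<n a))) (trans e (m<n⇒m%n≡m (toℕ<n b))))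

  sum≡𝟙⇒ : ∀ {n} (v : Vec Zp n) → sumZ v ≡ 𝟙 → ⟦ v ⟧ ≈ 1
  sum≡𝟙⇒ v e = trans (sym (sumZ≈ v)) (trans (cong (λ x → toℕ x % p) e) (ι-toℕ≈ 1))

  ⇒sum≡𝟙 : ∀ {n} (v : Vec Zp n) → ⟦ v ⟧ ≈ 1 → sumZ v ≡ 𝟙
  ⇒sum≡𝟙 v e = ≈⇒≡ (trans (sumZ≈ v) (trans e (sym (ι-toℕ≈ 1))))

  ⟦++⟧ : ∀ {m n} (xs : Vec Zp m) (ys : Vec Zp n) → ⟦ xs ++ ys ⟧ ≡ ⟦ xs ⟧ + ⟦ ys ⟧
  ⟦++⟧ []       ys = refl
  ⟦++⟧ (x ∷ xs) ys = trans (cong (toℕ x +_) (⟦++⟧ xs ys)) (sym (+-assoc (toℕ x) _ _))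

  ⟦map⊗⟧ : ∀ {k} (a : Zp) (g : Vec Zp k) → ⟦ map (a ⊗_) g ⟧ ≈ (toℕ a * ⟦ g ⟧)
  ⟦map⊗⟧ a []      = cong (_% p) (sym (*-zeroʳ (toℕ a)))
  ⟦map⊗⟧ a (x ∷ g) = trans (≈-+ (ι-toℕ≈ (toℕ a * toℕ x)) (⟦map⊗⟧ a g))
                           (cong (_% p) (sym (*-distribˡ-+ (toℕ a) (toℕ x) ⟦ g ⟧)))

  ⟦comp⟧ : ∀ {n} (π : Vec Zp n) (ks : Vec ℕ n) (γ : (i : Fin n) → Vec Zp (lookup ks i)) →
           (∀ i → ⟦ γ i ⟧ ≈ 1) → ⟦ compVec π ks γ ⟧ ≈ ⟦ π ⟧
  ⟦comp⟧ []      []       γ h = refl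
  ⟦comp⟧ (a ∷ π) (k ∷ ks) γ h =
    trans (cong (_% p) (⟦++⟧ (map (a ⊗_) (γ Fin.zero)) (compVec π ks (γ ∘ Fin.suc))))
      (≈-+ (trans (⟦map⊗⟧ a (γ Fin.zero))
                  (trans (≈-* {toℕ a} refl (h Fin.zero)) (cong (_% p) (*-identityʳ (toℕ a)))))
           (⟦comp⟧ π ks (γ ∘ Fin.suc) (h ∘ Fin.suc)))
    where import Data.Fin as Fin

  _∘ᵖ_ : ∀ {n} {ks : Vec ℕ n} → Π n → ((i : Fin n) → Π (lookup ks i)) → Π (V.sum ks)
  _∘ᵖ_ {n} {ks} π γ =
    compVec (proj₁ π) ks (proj₁ ∘ γ) ,
    ⇒sum≡𝟙 (compVec (proj₁ π) ks (proj₁ ∘ γ))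
      (trans (⟦comp⟧ (proj₁ π) ks (proj₁ ∘ γ) (λ i → sum≡𝟙⇒ (proj₁ (γ i)) (proj₂ (γ i))))
             (sum≡𝟙⇒ (proj₁ π) (proj₂ π)))

  Σᶠ : ∀ {n} → (Fin n → Zp) → Zp
  Σᶠ f = sumZ (tabulate f)

  coprime : ∀ {n} → p ∤ n → Coprime n p
  coprime {n} h {d} (d∣n , d∣p) with prime⇒irreducible pr d∣p
  ... | inj₁ d≡1 = d≡1
  ... | inj₂ refl = contradiction d∣n h

  invℕ : ∀ {n} → p ∤ n → Σ ℕ (λ x → (x * n) ≈ 1)
  invℕ {n} h with coprime-Bézout (coprime h)
  ... | Bézout.+- x y eq = x , (begin
        (x * n) % p         ≡⟨ cong (_% p) (sym eq) ⟩
        (1 + y * p) % p     ≡⟨ [m+kn]%n≡m%n 1 y p ⟩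
        1 % p ∎)
    where open ≡-Reasoning
  ... | Bézout.-+ x y eq = (p ∸ 1) * x , (begin
        ((p ∸ 1) * x * n) % p             ≡⟨ sym ([m+n]%n≡m%n _ p) ⟩
        ((p ∸ 1) * x * n + p) % p         ≡⟨ cong (_% p) (key p {{p≢0}} eq) ⟩
        (1 + ((p ∸ 1) * y) * p) % p       ≡⟨ [m+kn]%n≡m%n 1 ((p ∸ 1) * y) p ⟩
        1 % p ∎)
    where
    open ≡-Reasoning
    key : ∀ q .{{_ : NonZero q}} → 1 + x * n ≡ y * q → (q ∸ 1) * x * n + q ≡ 1 + ((q ∸ 1) * y) * q
    key (suc r) e = begin
      r * x * n + suc r          ≡⟨ solve 3 (λ r x n → r :* x :* n :+ (con 1 :+ r) := con 1 :+ r :* (con 1 :+ x :* n)) refl r x n ⟩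
      1 + r * (1 + x * n)        ≡⟨ cong (λ z → 1 + r * z) e ⟩
      1 + r * (y * suc r)        ≡⟨ cong (1 +_) (sym (*-assoc r y (suc r))) ⟩
      1 + r * y * suc r ∎
      where open +-*-Solver

  inv : ∀ {n} → p ∤ n → Zp
  inv h = ι (proj₁ (invℕ h))

  ⟦replicate⟧ : ∀ n (c : Zp) → ⟦ replicate n c ⟧ ≡ n * toℕ c
  ⟦replicate⟧ zero    c = refl
  ⟦replicate⟧ (suc n) c = cong (toℕ c +_) (⟦replicate⟧ n c)

  u : ∀ n → p ∤ n → Π n
  u n h = replicate n (inv h) , ⇒sum≡𝟙 (replicate n (inv h)) (begin
      ⟦ replicate n (inv h) ⟧ % p         ≡⟨ cong (_% p) (⟦replicate⟧ n (inv h)) ⟩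
      (n * toℕ (inv h)) % p               ≡⟨ ≈-* {n} refl (ι-toℕ≈ x) ⟩
      (n * x) % p                         ≡⟨ cong (_% p) (*-comm n x) ⟩
      (x * n) % p                         ≡⟨ proj₂ (invℕ h) ⟩
      1 % p ∎)
    where
    open ≡-Reasoning
    x = proj₁ (invℕ h)

  ∤-shift : ∀ {n} → p ∤ n → p ∤ (n + p ^ 2)
  ∤-shift {n} h d = h (∣m+n∣m⇒∣n (subst (p ∣_) (+-comm n (p ^ 2)) d) (m∣m*n (p ^ 1)))

{-# OPTIONS --safe #-}
-- The chain rule, applied to a constant vector split into one block of length
-- k ≡ 1 (mod p) and blocks of length 1, reduces I on constant vectors to the
-- values I(1,…,1) on all-ones vectors.  These vanish on length 1 and are
-- additive in the length: I(1,…,1) on 1 + cp entries is c·I(1,…,1) on 1 + p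
-- entries, hence 0 for c = p.  Splitting u_{n+p²} into one block of length
-- 1 + p² and n − 1 blocks of length 1 then gives I(u_{n+p²}) = I(u_n).
module Submission where

open import Defs
open import Data.Nat using (ℕ; zero; suc; _+_; _*_; _∸_; _^_; _<_)
open import Data.Nat.Properties using (+-identityʳ; *-identityˡ; *-identityʳ; *-zeroʳ; *-comm; m+[n∸m]≡n; <⇒≤)
open import Data.Nat.DivMod using (_%_; n%n≡0; m*n%n≡0; [m+n]%n≡m%n; [m+kn]%n≡m%n)
open import Data.Nat.Divisibility using (_∤_; _∣0)
open import Data.Nat.Primality using (Prime)
open import Data.Nat.Solver using (module +-*-Solver)
open import Data.Fin using (Fin; toℕ; _≟_)
import Data.Fin as Fin
open import Data.Fin.Properties using (toℕ<n)
open import Data.Vec using (Vec; []; _∷_; lookup; map; _++_; replicate; sum)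
open import Data.Vec.Properties using (lookup-replicate; map-replicate; tabulate-cong)
open import Data.Product using (_,_; proj₁; proj₂)
open import Data.Empty using (⊥-elim)
open import Function using (_∘_)
open import Relation.Binary.PropositionalEquality
open import Axiom.UniquenessOfIdentityProofs using (module Decidable⇒UIP)

replicate-++ : ∀ {A : Set} m n (a : A) → replicate m a ++ replicate n a ≡ replicate (m + n) a
replicate-++ zero    n a = refl
replicate-++ (suc m) n a = cong (a ∷_) (replicate-++ m n a)

sum-replicate-1 : ∀ m → sum (replicate m 1) ≡ m
sum-replicate-1 zero    = refl
sum-replicate-1 (suc m) = cong suc (sum-replicate-1 m)

module _ (p : ℕ) (pr : Prime p) where
  open ZMod p pr
  open ≡-Reasoning

  m≈m+n⇒n≈0 : ∀ {m n} → m < p → m ≈ (m + n) → n ≈ 0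
  m≈m+n⇒n≈0 {m} {n} m<p m≈m+n = begin
    n % p                   ≡⟨ sym ([m+n]%n≡m%n n p) ⟩
    (n + p) % p             ≡⟨ cong (λ z → (n + z) % p) (m+[n∸m]≡n (<⇒≤ m<p)) ⟨
    (n + (m + q)) % p       ≡⟨ cong (_% p) (solve 3 (λ m n q → n :+ (m :+ q) := (m :+ n) :+ q) refl m n q) ⟩
    ((m + n) + q) % p       ≡⟨ ≈-+ {m + n} {m} {q} (sym m≈m+n) refl ⟩
    (m + q) % p             ≡⟨ cong (_% p) (m+[n∸m]≡n (<⇒≤ m<p)) ⟩
    p % p                   ≡⟨ n%n≡0 p ⟩
    0                       ≡⟨ m*n%n≡0 0 p ⟨
    0 % p                   ∎
    where
    open +-*-Solver
    q = p ∸ m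

  ≈0⇒≡𝟘 : ∀ {a} → toℕ a ≈ 0 → a ≡ 𝟘
  ≈0⇒≡𝟘 a≈0 = ≈⇒≡ (trans a≈0 (sym (ι-toℕ≈ 0)))

  ⊕-identityʳ : ∀ a → a ⊕ 𝟘 ≡ a
  ⊕-identityʳ a = ≈⇒≡ (begin
    toℕ (a ⊕ 𝟘) % p         ≡⟨ ι-toℕ≈ _ ⟩
    (toℕ a + toℕ 𝟘) % p     ≡⟨ ≈-+ {toℕ a} refl (ι-toℕ≈ 0) ⟩
    (toℕ a + 0) % p         ≡⟨ cong (_% p) (+-identityʳ (toℕ a)) ⟩
    toℕ a % p               ∎)

  ⊗-identityˡ : ∀ a → 𝟙 ⊗ a ≡ a
  ⊗-identityˡ a = ≈⇒≡ (begin
    toℕ (𝟙 ⊗ a) % p         ≡⟨ ι-toℕ≈ _ ⟩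
    (toℕ 𝟙 * toℕ a) % p     ≡⟨ ≈-* (ι-toℕ≈ 1) refl ⟩
    (1 * toℕ a) % p         ≡⟨ cong (_% p) (*-identityˡ (toℕ a)) ⟩
    toℕ a % p               ∎)

  ⊗-identityʳ : ∀ a → a ⊗ 𝟙 ≡ a
  ⊗-identityʳ a = ≈⇒≡ (begin
    toℕ (a ⊗ 𝟙) % p         ≡⟨ ι-toℕ≈ _ ⟩
    (toℕ a * toℕ 𝟙) % p     ≡⟨ ≈-* {toℕ a} refl (ι-toℕ≈ 1) ⟩
    (toℕ a * 1) % p         ≡⟨ cong (_% p) (*-identityʳ (toℕ a)) ⟩
    toℕ a % p               ∎)

  ⊗-zeroʳ : ∀ a → a ⊗ 𝟘 ≡ 𝟘
  ⊗-zeroʳ a = ≈0⇒≡𝟘 (begin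
    toℕ (a ⊗ 𝟘) % p         ≡⟨ ι-toℕ≈ _ ⟩
    (toℕ a * toℕ 𝟘) % p     ≡⟨ ≈-* {toℕ a} refl (ι-toℕ≈ 0) ⟩
    (toℕ a * 0) % p         ≡⟨ cong (_% p) (*-zeroʳ (toℕ a)) ⟩
    0 % p                   ∎)

  a≡a⊕b⇒b≡𝟘 : ∀ {a b} → a ≡ a ⊕ b → b ≡ 𝟘
  a≡a⊕b⇒b≡𝟘 {a} {b} a≡a⊕b =
    ≈0⇒≡𝟘 (m≈m+n⇒n≈0 (toℕ<n a) (trans (cong (λ z → toℕ z % p) a≡a⊕b) (ι-toℕ≈ _)))

  Σᶠ-cong : ∀ {n} {f g : Fin n → Zp} → (∀ i → f i ≡ g i) → Σᶠ f ≡ Σᶠ g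
  Σᶠ-cong f≗g = cong sumZ (tabulate-cong f≗g)

  toℕ-Σᶠ-const : ∀ m a → toℕ (Σᶠ {m} (λ _ → a)) ≈ (m * toℕ a)
  toℕ-Σᶠ-const zero    a = ι-toℕ≈ 0
  toℕ-Σᶠ-const (suc m) a = trans (ι-toℕ≈ _) (≈-+ {toℕ a} refl (toℕ-Σᶠ-const m a))

  Σᶠ-const-𝟘 : ∀ m → Σᶠ {m} (λ _ → 𝟘) ≡ 𝟘
  Σᶠ-const-𝟘 m = ≈0⇒≡𝟘 (begin
    toℕ (Σᶠ {m} (λ _ → 𝟘)) % p  ≡⟨ toℕ-Σᶠ-const m 𝟘 ⟩
    (m * toℕ 𝟘) % p             ≡⟨ ≈-* {m} refl (ι-toℕ≈ 0) ⟩
    (m * 0) % p                 ≡⟨ cong (_% p) (*-zeroʳ m) ⟩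
    0 % p                       ∎)

  Σᶠ-const-p : ∀ a → Σᶠ {p} (λ _ → a) ≡ 𝟘
  Σᶠ-const-p a = ≈0⇒≡𝟘 (begin
    toℕ (Σᶠ {p} (λ _ → a)) % p  ≡⟨ toℕ-Σᶠ-const p a ⟩
    (p * toℕ a) % p             ≡⟨ cong (_% p) (*-comm p (toℕ a)) ⟩
    (toℕ a * p) % p             ≡⟨ m*n%n≡0 (toℕ a) p ⟩
    0                           ≡⟨ m*n%n≡0 0 p ⟨
    0 % p                       ∎)

  inv-cong : ∀ {m n} (hm : p ∤ m) (hn : p ∤ n) → m ≈ n → inv hm ≡ inv hn
  inv-cong {m} {n} hm hn m≈n = ≈⇒≡ (begin
    toℕ (inv hm) % p        ≡⟨ ι-toℕ≈ a ⟩
    a % p                   ≡⟨ cong (_% p) (*-identityʳ a) ⟨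
    (a * 1) % p             ≡⟨ ≈-* {a} refl bn≈1 ⟨
    (a * (b * n)) % p       ≡⟨ cong (_% p) (solve 3 (λ a b n → a :* (b :* n) := b :* (a :* n)) refl a b n) ⟩
    (b * (a * n)) % p       ≡⟨ ≈-* {b} refl (≈-* {a} refl m≈n) ⟨
    (b * (a * m)) % p       ≡⟨ ≈-* {b} refl am≈1 ⟩
    (b * 1) % p             ≡⟨ cong (_% p) (*-identityʳ b) ⟩
    b % p                   ≡⟨ ι-toℕ≈ b ⟨
    toℕ (inv hn) % p        ∎)
    where
    open +-*-Solver
    a = proj₁ (invℕ hm)
    am≈1 = proj₂ (invℕ hm)
    b = proj₁ (invℕ hn)
    bn≈1 = proj₂ (invℕ hn)

  Π-≡ : ∀ {n} {x y : Π n} → proj₁ x ≡ proj₁ y → x ≡ y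
  Π-≡ {x = v , _} refl = cong (v ,_) (Decidable⇒UIP.≡-irrelevant _≟_ _ _)

  cong-Π-replicate : ∀ {A : Set} (f : (n : ℕ) → Π n → A) {m n c d} → m ≡ n → c ≡ d →
                     (x : Π m) (y : Π n) → proj₁ x ≡ replicate m c → proj₁ y ≡ replicate n d →
                     f m x ≡ f n y
  cong-Π-replicate f refl refl x y x≡c y≡c = cong (f _) (Π-≡ (trans x≡c (sym y≡c)))

  ones : ∀ L → L ≈ 1 → Π L
  ones L L≈1 = replicate L 𝟙 , ⇒sum≡𝟙 (replicate L 𝟙) (begin
    ⟦ replicate L 𝟙 ⟧ % p   ≡⟨ cong (_% p) (⟦replicate⟧ L 𝟙) ⟩
    (L * toℕ 𝟙) % p         ≡⟨ ≈-* {L} refl (ι-toℕ≈ 1) ⟩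
    (L * 1) % p             ≡⟨ cong (_% p) (*-identityʳ L) ⟩
    L % p                   ≡⟨ L≈1 ⟩
    1 % p                   ∎)

  compVec-replicate : ∀ {n} (ks : Vec ℕ n) c d →
                      compVec (replicate n c) ks (λ i → replicate (lookup ks i) d) ≡ replicate (sum ks) (c ⊗ d)
  compVec-replicate []       c d = refl
  compVec-replicate (k ∷ ks) c d = begin
    map (c ⊗_) (replicate k d) ++ compVec (replicate _ c) ks (λ i → replicate (lookup ks i) d)
      ≡⟨ cong₂ _++_ (map-replicate (c ⊗_) d k) (compVec-replicate ks c d) ⟩
    replicate k (c ⊗ d) ++ replicate (sum ks) (c ⊗ d)
      ≡⟨ replicate-++ k (sum ks) (c ⊗ d) ⟩
    replicate (k + sum ks) (c ⊗ d) ∎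

  ChainRule : ((n : ℕ) → Π n → Zp) → Set
  ChainRule I = ∀ (n : ℕ) (ks : Vec ℕ n) (π : Π n) (γ : (i : Fin n) → Π (lookup ks i)) →
    I (sum ks) (_∘ᵖ_ {ks = ks} π γ) ≡ I n π ⊕ Σᶠ (λ i → (π ! i) ⊗ I (lookup ks i) (γ i))

  module _ (I : (n : ℕ) → Π n → Zp) (chain : ChainRule I) where

    Iᵒ : ∀ L → L ≈ 1 → Zp
    Iᵒ L L≈1 = I L (ones L L≈1)

    Iᵒ-cong : ∀ {m n} (m≈1 : m ≈ 1) (n≈1 : n ≈ 1) → m ≡ n → Iᵒ m m≈1 ≡ Iᵒ n n≈1
    Iᵒ-cong m≈1 n≈1 m≡n = cong-Π-replicate I m≡n refl (ones _ m≈1) (ones _ n≈1) refl refl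

    I-graft : ∀ {N} m k (k≈1 : k ≈ 1) c (x : Π N) (y : Π (suc m)) → N ≡ k + m →
              proj₁ x ≡ replicate N c → proj₁ y ≡ replicate (suc m) c →
              I N x ≡ I (suc m) y ⊕ (c ⊗ Iᵒ k k≈1 ⊕ Σᶠ {m} (λ _ → c ⊗ Iᵒ 1 refl))
    I-graft m k k≈1 c x y N≡k+m x≡c y≡c = begin
      I _ x                                     ≡⟨ cong-Π-replicate I N≡sum (sym (⊗-identityʳ c)) x (y ∘ᵖ γ) x≡c y∘γ≡c ⟩
      I (sum ks) (y ∘ᵖ γ)                       ≡⟨ chain (suc m) ks y γ ⟩
      I (suc m) y ⊕ Σᶠ (λ i → (y ! i) ⊗ I (lookup ks i) (γ i))
        ≡⟨ cong (I (suc m) y ⊕_) (cong₂ _⊕_ (cong (_⊗ Iᵒ k k≈1) (y!≡c Fin.zero)) (Σᶠ-cong tail≡)) ⟩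
      I (suc m) y ⊕ (c ⊗ Iᵒ k k≈1 ⊕ Σᶠ {m} (λ _ → c ⊗ Iᵒ 1 refl)) ∎
      where
      ks : Vec ℕ (suc m)
      ks = k ∷ replicate m 1
      ks≈1 : ∀ i → lookup ks i ≈ 1
      ks≈1 Fin.zero    = k≈1
      ks≈1 (Fin.suc i) = cong (_% p) (lookup-replicate i 1)
      γ : (i : Fin (suc m)) → Π (lookup ks i)
      γ i = ones (lookup ks i) (ks≈1 i)
      N≡sum : _ ≡ sum ks
      N≡sum = trans N≡k+m (cong (k +_) (sym (sum-replicate-1 m)))
      y∘γ≡c : proj₁ (y ∘ᵖ γ) ≡ replicate (sum ks) (c ⊗ 𝟙)
      y∘γ≡c = trans (cong (λ v → compVec v ks (proj₁ ∘ γ)) y≡c) (compVec-replicate ks c 𝟙)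
      y!≡c : ∀ i → y ! i ≡ c
      y!≡c i = trans (cong (λ v → lookup v i) y≡c) (lookup-replicate i c)
      tail≡ : ∀ i → (y ! Fin.suc i) ⊗ I _ (γ (Fin.suc i)) ≡ c ⊗ Iᵒ 1 refl
      tail≡ i = cong₂ _⊗_ (y!≡c (Fin.suc i)) (Iᵒ-cong _ refl (lookup-replicate i 1))

    Iᵒ-1≡𝟘 : Iᵒ 1 refl ≡ 𝟘
    Iᵒ-1≡𝟘 = a≡a⊕b⇒b≡𝟘 (begin
      Iᵒ 1 refl                              ≡⟨ I-graft 0 1 refl 𝟙 (ones 1 refl) (ones 1 refl) refl refl refl ⟩
      Iᵒ 1 refl ⊕ (𝟙 ⊗ Iᵒ 1 refl ⊕ 𝟘)        ≡⟨ cong (Iᵒ 1 refl ⊕_) (⊕-identityʳ _) ⟩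
      Iᵒ 1 refl ⊕ 𝟙 ⊗ Iᵒ 1 refl              ≡⟨ cong (Iᵒ 1 refl ⊕_) (⊗-identityˡ _) ⟩
      Iᵒ 1 refl ⊕ Iᵒ 1 refl                  ∎)

    I-graft-constant : ∀ {N} m k (k≈1 : k ≈ 1) c (x : Π N) (y : Π (suc m)) → N ≡ k + m →
                       proj₁ x ≡ replicate N c → proj₁ y ≡ replicate (suc m) c →
                       I N x ≡ I (suc m) y ⊕ c ⊗ Iᵒ k k≈1
    I-graft-constant m k k≈1 c x y N≡k+m x≡c y≡c = begin
      I _ x                                                   ≡⟨ I-graft m k k≈1 c x y N≡k+m x≡c y≡c ⟩
      I (suc m) y ⊕ (c ⊗ Iᵒ k k≈1 ⊕ Σᶠ {m} (λ _ → c ⊗ Iᵒ 1 refl))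
        ≡⟨ cong (λ z → I (suc m) y ⊕ (c ⊗ Iᵒ k k≈1 ⊕ Σᶠ {m} (λ _ → c ⊗ z))) Iᵒ-1≡𝟘 ⟩
      I (suc m) y ⊕ (c ⊗ Iᵒ k k≈1 ⊕ Σᶠ {m} (λ _ → c ⊗ 𝟘))
        ≡⟨ cong (λ z → I (suc m) y ⊕ (c ⊗ Iᵒ k k≈1 ⊕ z)) (trans (Σᶠ-cong {m} (λ _ → ⊗-zeroʳ c)) (Σᶠ-const-𝟘 m)) ⟩
      I (suc m) y ⊕ (c ⊗ Iᵒ k k≈1 ⊕ 𝟘)                        ≡⟨ cong (I (suc m) y ⊕_) (⊕-identityʳ _) ⟩
      I (suc m) y ⊕ c ⊗ Iᵒ k k≈1                              ∎

    1+kp≈1 : ∀ k → (1 + k * p) ≈ 1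
    1+kp≈1 k = [m+kn]%n≡m%n 1 k p

    1+p≈1 : (1 + p) ≈ 1
    1+p≈1 = [m+n]%n≡m%n 1 p

    Iᵒ-1+[1+k]p : ∀ k → Iᵒ (1 + suc k * p) (1+kp≈1 (suc k)) ≡ Iᵒ (1 + p) 1+p≈1 ⊕ Iᵒ (1 + k * p) (1+kp≈1 k)
    Iᵒ-1+[1+k]p k = begin
      Iᵒ (1 + suc k * p) _                              ≡⟨ I-graft-constant p (1 + k * p) (1+kp≈1 k) 𝟙 (ones _ _) (ones _ 1+p≈1) length≡ refl refl ⟩
      Iᵒ (1 + p) 1+p≈1 ⊕ 𝟙 ⊗ Iᵒ (1 + k * p) (1+kp≈1 k) ≡⟨ cong (Iᵒ (1 + p) 1+p≈1 ⊕_) (⊗-identityˡ _) ⟩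
      Iᵒ (1 + p) 1+p≈1 ⊕ Iᵒ (1 + k * p) (1+kp≈1 k)     ∎
      where
      open +-*-Solver
      length≡ : 1 + suc k * p ≡ (1 + k * p) + p
      length≡ = solve 2 (λ k p → con 1 :+ (con 1 :+ k) :* p := (con 1 :+ k :* p) :+ p) refl k p

    Iᵒ-1+kp≡Σᶠ : ∀ k → Iᵒ (1 + k * p) (1+kp≈1 k) ≡ Σᶠ {k} (λ _ → Iᵒ (1 + p) 1+p≈1)
    Iᵒ-1+kp≡Σᶠ zero    = trans (Iᵒ-cong _ refl refl) Iᵒ-1≡𝟘
    Iᵒ-1+kp≡Σᶠ (suc k) = trans (Iᵒ-1+[1+k]p k) (cong (Iᵒ (1 + p) 1+p≈1 ⊕_) (Iᵒ-1+kp≡Σᶠ k))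

    Iᵒ-1+p²≡𝟘 : Iᵒ (1 + p * p) (1+kp≈1 p) ≡ 𝟘
    Iᵒ-1+p²≡𝟘 = trans (Iᵒ-1+kp≡Σᶠ p) (Σᶠ-const-p _)

    I-u-periodic : ∀ n (h : p ∤ n) → I (n + p ^ 2) (u (n + p ^ 2) (∤-shift h)) ≡ I n (u n h)
    I-u-periodic zero     h = ⊥-elim (h (p ∣0))
    I-u-periodic (suc n) h = begin
      I (suc n + p ^ 2) (u _ (∤-shift h))       ≡⟨ I-graft-constant n (1 + p * p) (1+kp≈1 p) (inv h) (u _ (∤-shift h)) (u _ h)
                                                     length≡ (cong (replicate _) (inv-cong (∤-shift h) h (sym n≈n+p²))) refl ⟩
      I (suc n) (u _ h) ⊕ inv h ⊗ Iᵒ (1 + p * p) (1+kp≈1 p)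
                                                ≡⟨ cong (λ z → I (suc n) (u _ h) ⊕ inv h ⊗ z) Iᵒ-1+p²≡𝟘 ⟩
      I (suc n) (u _ h) ⊕ inv h ⊗ 𝟘             ≡⟨ cong (I (suc n) (u _ h) ⊕_) (⊗-zeroʳ (inv h)) ⟩
      I (suc n) (u _ h) ⊕ 𝟘                     ≡⟨ ⊕-identityʳ _ ⟩
      I (suc n) (u _ h)                         ∎
      where
      open +-*-Solver
      length≡ : suc n + p ^ 2 ≡ (1 + p * p) + n
      length≡ = solve 2 (λ n p → (con 1 :+ n) :+ p :^ 2 := (con 1 :+ p :* p) :+ n) refl n p
      n≈n+p² : suc n ≈ (suc n + p ^ 2)
      n≈n+p² = sym (trans (cong (λ z → (suc n + z) % p) (solve 1 (λ p → p :^ 2 := p :* p) refl p)) ([m+kn]%n≡m%n (suc n) p p))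

lemma5p6 : (p : ℕ) (pr : Prime p) → let open ZMod p pr in
    (I : (n : ℕ) → Π n → Zp) →
    (∀ (n : ℕ) (ks : Vec ℕ n) (π : Π n) (γ : (i : Fin n) → Π (lookup ks i)) →
    I (sum ks) (_∘ᵖ_ {ks = ks} π γ) ≡ I n π ⊕ Σᶠ (λ i → (π ! i) ⊗ I (lookup ks i) (γ i))) →
    ∀ (n : ℕ) (h : p ∤ n) → I (n + p ^ 2) (u (n + p ^ 2) (∤-shift h)) ≡ I n (u n h)
lemma5p6 = I-u-periodic
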